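{- Let $G$ be a simple, $3$-vertex-connected graph with $\operatorname{gon}(G)=3$, and let $D$ be an effective divisor with $r(D)=1$ and $\deg(D)=3$. If $D\sim(v_1)+(v_2)+(v_3)$ for vertices $v_1,v_2,v_3$, then either $v_1=v_2=v_3$, or $v_1,v_2,v_3$ are pairwise distinct.
   Context: A graph is finite, connected, loopless; simple means no multiple edges. $3$-vertex-connected means deleting any $2$ vertices leaves the graph connected (for a complete graph the convention is that its vertex-connectivity is $|V|-1$). Divisors are integer combinations of vertices; $D\sim D'$ if $D-D'$ is in the image of the Laplacian ($\Delta_{v,v}=\mathrm{val}(v)$, $\Delta_{v,w}=-$number of edges between $v,w$). The rank $r(D)$ is $-1$ if no effective divisor is equivalent to $D$, and otherwise the largest $k$ such that for every effective divisor $F$ of degree $k$ some effective divisor is equivalent to $D-F$. $\operatorname{gon}(G)$ is the minimum degree of an effective divisor of rank $\ge1$. -}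

module Defs where

open import Data.Nat as ℕ using (ℕ; zero; suc)
open import Data.Integer as ℤ using (ℤ; +_; _+_; _-_; _*_; -_)
open import Data.Fin using (Fin; zero; suc; _≟_)
open import Data.Bool using (Bool; true; false)
open import Data.Product using (Σ; ∃; _×_; _,_)
open import Relation.Nullary using (¬_; yes; no)
open import Relation.Binary.PropositionalEquality using (_≡_; _≢_)

record SimpleGraph (n : ℕ) : Set where
  field
    adj     : Fin n → Fin n → Bool
    adj-sym : ∀ u v → adj u v ≡ adj v u
    loopless : ∀ v → adj v v ≡ false
open SimpleGraph public

Σℤ : ∀ {n} → (Fin n → ℤ) → ℤ
Σℤ {zero}  f = + 0
Σℤ {suc n} f = f zero + Σℤ (λ i → f (suc i))

edges : ∀ {n} → SimpleGraph n → Fin n → Fin n → ℤ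
edges G v w with adj G v w
... | true  = + 1
... | false = + 0

val : ∀ {n} → SimpleGraph n → Fin n → ℤ
val G v = Σℤ (λ w → edges G v w)

Δ : ∀ {n} → SimpleGraph n → Fin n → Fin n → ℤ
Δ G v w with v ≟ w
... | yes _ = val G v
... | no  _ = - edges G v w

Lap : ∀ {n} → SimpleGraph n → (Fin n → ℤ) → Fin n → ℤ
Lap G f v = Σℤ (λ w → Δ G v w * f w)

-- Connectivity of the subgraph induced on the vertices with keep v ≡ true.
data Reach {n} (G : SimpleGraph n) (keep : Fin n → Bool) : Fin n → Fin n → Set where
  here : ∀ {u} → Reach G keep u u
  step : ∀ {u w v} → adj G u w ≡ true → keep w ≡ true → Reach G keep w v → Reach G keep u v

InducedConnected : ∀ {n} → SimpleGraph n → (Fin n → Bool) → Set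
InducedConnected G keep =
  ∀ u v → keep u ≡ true → keep v ≡ true → Reach G keep u v

Connected : ∀ {n} → SimpleGraph n → Set
Connected G = InducedConnected G (λ _ → true)

-- G minus the vertices a and b (a ≡ b allowed)
without : ∀ {n} → Fin n → Fin n → Fin n → Bool
without a b v with v ≟ a | v ≟ b
... | yes _ | _     = false
... | no _  | yes _ = false
... | no _  | no _  = true

-- 3-vertex-connected: vertex connectivity ≥ 3, i.e. more than 3 vertices
-- (complete-graph convention κ(K_n) = n-1) and deleting any ≤ 2 vertices
-- leaves the graph connected.
ThreeConnected : ∀ {n} → SimpleGraph n → Set
ThreeConnected {n} G =
  (4 ℕ.≤ n) × Connected G × (∀ a b → InducedConnected G (without a b))

Divisor : ℕ → Set
Divisor n = Fin n → ℤ

deg : ∀ {n} → Divisor n → ℤ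
deg D = Σℤ D

Effective : ∀ {n} → Divisor n → Set
Effective D = ∀ v → + 0 ℤ.≤ D v

_-ᴰ_ : ∀ {n} → Divisor n → Divisor n → Divisor n
(D -ᴰ E) v = D v - E v

LinEq : ∀ {n} → SimpleGraph n → Divisor n → Divisor n → Set
LinEq {n} G D D' = Σ (Fin n → ℤ) λ f → ∀ v → D v - D' v ≡ Lap G f v

HasEffEquiv : ∀ {n} → SimpleGraph n → Divisor n → Set
HasEffEquiv G D = Σ (Divisor _) λ E → Effective E × LinEq G D E

RankProp : ∀ {n} → SimpleGraph n → Divisor n → ℕ → Set
RankProp G D k = ∀ F → Effective F → deg F ≡ + k → HasEffEquiv G (D -ᴰ F)

RankIs : ∀ {n} → SimpleGraph n → Divisor n → ℕ → Set
RankIs G D k = HasEffEquiv G D × RankProp G D k × (∀ m → k ℕ.< m → ¬ RankProp G D m)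

RankAtLeast1 : ∀ {n} → SimpleGraph n → Divisor n → Set
RankAtLeast1 G D = ∃ λ k → 1 ℕ.≤ k × RankIs G D k

GonalityIs : ∀ {n} → SimpleGraph n → ℕ → Set
GonalityIs G g =
  (Σ (Divisor _) λ D → Effective D × RankAtLeast1 G D × deg D ≡ + g)
  × (∀ D → Effective D → RankAtLeast1 G D → + g ℤ.≤ deg D)

pt : ∀ {n} → Fin n → Divisor n
pt v w with v ≟ w
... | yes _ = + 1
... | no  _ = + 0

pt3 : ∀ {n} → Fin n → Fin n → Fin n → Divisor n
pt3 a b c w = pt a w + pt b w + pt c w

module Submission where

-- Suppose D ~ 2(v) + (w) with v ≠ w on a 3-connected simple
-- graph, and r(D) ≥ 1.  Pick a vertex q ∉ {v, w}; since r(D) ≥ 1 there is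
-- an effective E with E = 2(v) + (w) - (q) - Δh for some h (the difference
-- of the two Laplacian potentials).  Look at the vertices where h is
-- maximal.  At such a vertex x every lower neighbour contributes at least 1
-- to (Δh)(x), so E(x) ≥ 0 bounds the number of lower neighbours of x by the
-- "slack" (2(v) + (w) - (q))(x).  The slack is -1 at q, 0 off {v, w, q},
-- 1 at w and 2 at v.  Hence q is not a maximum; a maximum off {v, w} would,
-- by connectivity of G - {v, w}, give a maximum off {v, w, q} with a lower
-- neighbour; and 3-connectivity supplies two lower neighbours of w and
-- three of v.  So h has no maximum at all, which is absurd.  If the three
-- points v₁, v₂, v₃ are neither all equal nor pairwise distinct, then after
-- reordering D ~ 2(v) + (w), so the theorem follows.

open import Defs
open import Data.Nat using (ℕ)
open import Data.Integer using (+_)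
open import Data.Fin using (Fin)
open import Data.Product using (_×_)
open import Data.Sum using (_⊎_)
open import Relation.Binary.PropositionalEquality using (_≡_; _≢_)

import Data.Nat as ℕ
import Data.Nat.Properties as ℕP
open import Data.Integer as ℤ using (ℤ; _+_; _-_; _*_; _≤_; _<_; -[1+_])
import Data.Integer.Properties as ℤP
open import Data.Integer.Tactic.RingSolver using (solve-∀)
open import Data.Fin using (zero; suc; _≟_)
open import Data.Fin.Properties using (suc-injective; pigeonhole; ¬∀⟶∃¬; <⇒≢)
open import Data.Bool using (Bool; true; false)
open import Data.List using (List; []; _∷_; length; lookup)
open import Data.List.Membership.Propositional using (_∈_; _∉_)
import Data.List.Membership.DecPropositional as DecMembership
open import Data.List.Relation.Unary.All using (All; []; _∷_)
open import Data.List.Relation.Unary.Any using (here; there; index)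
open import Data.List.Relation.Unary.Any.Properties using (lookup-index)
open import Data.List.Relation.Unary.AllPairs using ([]; _∷_)
open import Data.List.Relation.Unary.Unique.Propositional using (Unique)
open import Data.Product using (∃; ∃₂; _,_; proj₁; proj₂)
open import Data.Sum using (inj₁; inj₂)
open import Data.Empty using (⊥; ⊥-elim)
open import Function using (_∘_)
open import Relation.Nullary using (¬_; yes; no; contradiction)
open import Relation.Unary using (Pred; Decidable)
open import Relation.Binary.PropositionalEquality
  using (refl; sym; trans; cong; cong₂; subst; module ≡-Reasoning)

Σ-+ : ∀ {n} (f g : Fin n → ℤ) → Σℤ (λ i → f i + g i) ≡ Σℤ f + Σℤ g
Σ-+ {ℕ.zero}  f g = refl
Σ-+ {ℕ.suc n} f g =
  trans (cong (λ s → f zero + g zero + s) (Σ-+ (f ∘ suc) (g ∘ suc)))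
    (interchange (f zero) (g zero) (Σℤ (f ∘ suc)) (Σℤ (g ∘ suc)))
  where
  interchange : ∀ a b c d → (a + b) + (c + d) ≡ (a + c) + (b + d)
  interchange = solve-∀

Σ-sub : ∀ {n} (f g : Fin n → ℤ) → Σℤ (λ i → f i - g i) ≡ Σℤ f - Σℤ g
Σ-sub {ℕ.zero}  f g = refl
Σ-sub {ℕ.suc n} f g =
  trans (cong (λ s → f zero - g zero + s) (Σ-sub (f ∘ suc) (g ∘ suc)))
    (interchange (f zero) (g zero) (Σℤ (f ∘ suc)) (Σℤ (g ∘ suc)))
  where
  interchange : ∀ a b c d → (a - b) + (c - d) ≡ (a + c) - (b + d)
  interchange = solve-∀

Σ-*ʳ : ∀ {n} (f : Fin n → ℤ) c → Σℤ (λ i → f i * c) ≡ Σℤ f * c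
Σ-*ʳ {ℕ.zero}  f c = sym (ℤP.*-zeroˡ c)
Σ-*ʳ {ℕ.suc n} f c =
  trans (cong (λ s → f zero * c + s) (Σ-*ʳ (f ∘ suc) c)) (sym (ℤP.*-distribʳ-+ c (f zero) _))

Σ-cong : ∀ {n} {f g : Fin n → ℤ} → (∀ i → f i ≡ g i) → Σℤ f ≡ Σℤ g
Σ-cong {ℕ.zero}  f≡g = refl
Σ-cong {ℕ.suc n} f≡g = cong₂ _+_ (f≡g zero) (Σ-cong (f≡g ∘ suc))

Σ-mono : ∀ {n} {f g : Fin n → ℤ} → (∀ i → f i ≤ g i) → Σℤ f ≤ Σℤ g
Σ-mono {ℕ.zero}  f≤g = ℤP.≤-refl
Σ-mono {ℕ.suc n} f≤g = ℤP.+-mono-≤ (f≤g zero) (Σ-mono (f≤g ∘ suc))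

Σ-zero : ∀ {n} {f : Fin n → ℤ} → (∀ i → f i ≡ + 0) → Σℤ f ≡ + 0
Σ-zero {ℕ.zero}  f≡0 = refl
Σ-zero {ℕ.suc n} f≡0 = cong₂ _+_ (f≡0 zero) (Σ-zero (f≡0 ∘ suc))

Σ-single : ∀ {n} (f : Fin n → ℤ) a → (∀ i → i ≢ a → f i ≡ + 0) → Σℤ f ≡ f a
Σ-single f zero    off-a =
  trans (cong (λ s → f zero + s) (Σ-zero (λ i → off-a (suc i) λ ()))) (ℤP.+-identityʳ (f zero))
Σ-single f (suc a) off-a =
  trans (cong (_+ Σℤ (f ∘ suc)) (off-a zero λ ()))
    (trans (ℤP.+-identityˡ _)
      (Σ-single (f ∘ suc) a (λ i i≢a → off-a (suc i) (i≢a ∘ suc-injective))))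

pt-self : ∀ {n} (a : Fin n) → pt a a ≡ + 1
pt-self a with a ≟ a
... | yes _   = refl
... | no a≢a = contradiction refl a≢a

pt-other : ∀ {n} {a b : Fin n} → a ≢ b → pt a b ≡ + 0
pt-other {a = a} {b} a≢b with a ≟ b
... | yes a≡b = contradiction a≡b a≢b
... | no _    = refl

pt-effective : ∀ {n} (a : Fin n) → Effective (pt a)
pt-effective a y with a ≟ y
... | yes _ = ℤ.+≤+ ℕ.z≤n
... | no _  = ℤ.+≤+ ℕ.z≤n

Σ-pt : ∀ {n} (a : Fin n) → Σℤ (pt a) ≡ + 1
Σ-pt a = trans (Σ-single (pt a) a (λ y y≢a → pt-other (y≢a ∘ sym))) (pt-self a)

Σ-sift : ∀ {n} (x : Fin n) (f : Fin n → ℤ) → Σℤ (λ y → pt x y * f y) ≡ f x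
Σ-sift x f =
  trans (Σ-single _ x (λ y y≢x → trans (cong (_* f y) (pt-other (y≢x ∘ sym))) (ℤP.*-zeroˡ (f y))))
    (trans (cong (_* f x) (pt-self x)) (ℤP.*-identityˡ (f x)))

*-distribˡ-sub : ∀ a b c → a * (b - c) ≡ a * b - a * c
*-distribˡ-sub = solve-∀

edges-true : ∀ {n} (G : SimpleGraph n) {x y} → adj G x y ≡ true → edges G x y ≡ + 1
edges-true G {x} {y} x~y with adj G x y
... | true = refl

edges-false : ∀ {n} (G : SimpleGraph n) {x y} → adj G x y ≡ false → edges G x y ≡ + 0
edges-false G {x} {y} x≁y with adj G x y
... | false = refl

edges-01 : ∀ {n} (G : SimpleGraph n) x y → edges G x y ≡ + 0 ⊎ edges G x y ≡ + 1
edges-01 G x y with adj G x y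
... | true  = inj₂ refl
... | false = inj₁ refl

adjacent⇒distinct : ∀ {n} (G : SimpleGraph n) {x y} → adj G x y ≡ true → x ≢ y
adjacent⇒distinct G {x} x~y refl with trans (sym x~y) (loopless G x)
... | ()

-- Since there are no loops, the Laplacian is val(x)·(x) minus the edge row.
Δ-split : ∀ {n} (G : SimpleGraph n) x y → Δ G x y ≡ pt x y * val G x - edges G x y
Δ-split G x y with x ≟ y
... | yes refl = sym (trans (cong (λ e → + 1 * val G x - e) (edges-false G (loopless G x)))
                            (trans (ℤP.+-identityʳ _) (ℤP.*-identityˡ _)))
... | no _ = sym (trans (cong (_- edges G x y) (ℤP.*-zeroˡ (val G x))) (ℤP.+-identityˡ _))

flow : ∀ {n} → SimpleGraph n → (Fin n → ℤ) → Fin n → Fin n → ℤ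
flow G h x y = edges G x y * (h x - h y)

outflow : ∀ {n} → SimpleGraph n → (Fin n → ℤ) → Fin n → ℤ
outflow G h x = Σℤ (flow G h x)

Lap-outflow : ∀ {n} (G : SimpleGraph n) h x → Lap G h x ≡ outflow G h x
Lap-outflow G h x = begin
    Σℤ (λ y → Δ G x y * h y)
  ≡⟨ Σ-cong (λ y → trans (cong (_* h y) (Δ-split G x y))
                          (expand (pt x y) (val G x) (edges G x y) (h y))) ⟩
    Σℤ (λ y → pt x y * (val G x * h y) - edges G x y * h y)
  ≡⟨ Σ-sub (λ y → pt x y * (val G x * h y)) (λ y → edges G x y * h y) ⟩
    Σℤ (λ y → pt x y * (val G x * h y)) - Σℤ (λ y → edges G x y * h y)
  ≡⟨ cong (_- Σℤ (λ y → edges G x y * h y))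
          (trans (Σ-sift x (λ y → val G x * h y)) (sym (Σ-*ʳ (edges G x) (h x)))) ⟩
    Σℤ (λ y → edges G x y * h x) - Σℤ (λ y → edges G x y * h y)
  ≡⟨ sym (Σ-sub (λ y → edges G x y * h x) (λ y → edges G x y * h y)) ⟩
    Σℤ (λ y → edges G x y * h x - edges G x y * h y)
  ≡⟨ Σ-cong (λ y → sym (*-distribˡ-sub (edges G x y) (h x) (h y))) ⟩
    outflow G h x
  ∎
  where
  open ≡-Reasoning
  expand : ∀ p v e k → (p * v - e) * k ≡ p * (v * k) - e * k
  expand = solve-∀

Lap-sub : ∀ {n} (G : SimpleGraph n) f g x → Lap G f x - Lap G g x ≡ Lap G (λ y → f y - g y) x
Lap-sub G f g x =
  sym (trans (Σ-cong (λ y → *-distribˡ-sub (Δ G x y) (f y) (g y)))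
         (Σ-sub (λ y → Δ G x y * f y) (λ y → Δ G x y * g y)))

IsMax : ∀ {n} → (Fin n → ℤ) → Fin n → Set
IsMax h x = ∀ y → h y ≤ h x

LowerNeighbour : ∀ {n} → SimpleGraph n → (Fin n → ℤ) → Fin n → Fin n → Set
LowerNeighbour G h x y = adj G x y ≡ true × h y < h x

flow-nonneg : ∀ {n} (G : SimpleGraph n) {h x} → IsMax h x → ∀ y → + 0 ≤ flow G h x y
flow-nonneg G {h} {x} x-max y with edges-01 G x y
... | inj₁ e≡0 rewrite e≡0 = ℤP.≤-reflexive (sym (ℤP.*-zeroˡ (h x - h y)))
... | inj₂ e≡1 rewrite e≡1 | ℤP.*-identityˡ (h x - h y) = ℤP.i≤j⇒0≤j-i (x-max y)

flow-lower : ∀ {n} (G : SimpleGraph n) {h x y} → LowerNeighbour G h x y → + 1 ≤ flow G h x y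
flow-lower G {h} {x} {y} (x~y , y<x) rewrite edges-true G x~y | ℤP.*-identityˡ (h x - h y) =
  subst (+ 1 ≤_) (cancel (h x) (h y))
    (ℤP.+-mono-≤ (ℤP.i≤j⇒0≤j-i (ℤP.i<j⇒suc[i]≤j y<x)) (ℤP.≤-refl {+ 1}))
  where
  cancel : ∀ a b → (a - (+ 1 + b)) + + 1 ≡ a - b
  cancel = solve-∀

sumPts : ∀ {n} → List (Fin n) → Divisor n
sumPts []       y = + 0
sumPts (z ∷ zs) y = pt z y + sumPts zs y

deg-sumPts : ∀ {n} (zs : List (Fin n)) → Σℤ (sumPts zs) ≡ + length zs
deg-sumPts {n} []  = Σ-zero {n} {sumPts []} (λ _ → refl)
deg-sumPts (z ∷ zs) =
  trans (Σ-+ (pt z) (sumPts zs)) (cong₂ _+_ (Σ-pt z) (deg-sumPts zs))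

sumPts-absent : ∀ {n} {y : Fin n} {zs} → All (y ≢_) zs → sumPts zs y ≡ + 0
sumPts-absent []             = refl
sumPts-absent (y≢z ∷ y∉zs) = cong₂ _+_ (pt-other (y≢z ∘ sym)) (sumPts-absent y∉zs)

sumPts≤flow : ∀ {n} (G : SimpleGraph n) {h x zs} → IsMax h x → Unique zs →
  All (LowerNeighbour G h x) zs → ∀ y → sumPts zs y ≤ flow G h x y
sumPts≤flow G x-max []             []                y = flow-nonneg G x-max y
sumPts≤flow G {h} {x} {z ∷ zs} x-max (z∉zs ∷ uniq) (z-lower ∷ lower) y with z ≟ y
... | yes refl rewrite sumPts-absent z∉zs = flow-lower G z-lower
... | no _ = subst (_≤ flow G h x y) (sym (ℤP.+-identityˡ (sumPts zs y)))
                   (sumPts≤flow G x-max uniq lower y)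

outflow-bound : ∀ {n} (G : SimpleGraph n) {h x zs} → IsMax h x → Unique zs →
  All (LowerNeighbour G h x) zs → + length zs ≤ outflow G h x
outflow-bound G {zs = zs} x-max uniq lower =
  subst (_≤ _) (deg-sumPts zs) (Σ-mono (sumPts≤flow G x-max uniq lower))

argmax : ∀ {n} (h : Fin n → ℤ) → Fin n → ∃ (IsMax h)
argmax {ℕ.suc ℕ.zero}    h _ = zero , λ { zero → ℤP.≤-refl }
argmax {ℕ.suc (ℕ.suc n)} h _ with argmax (h ∘ suc) zero
... | m , m-max with ℤP.≤-total (h zero) (h (suc m))
... | inj₁ h0≤hm = suc m , λ { zero → h0≤hm ; (suc i) → m-max i }
... | inj₂ hm≤h0 = zero  , λ { zero → ℤP.≤-refl ; (suc i) → ℤP.≤-trans (m-max i) hm≤h0 }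

fresh : ∀ {n} (xs : List (Fin n)) → length xs ℕ.< n → ∃ λ z → z ∉ xs
fresh {n} xs short = ¬∀⟶∃¬ n (_∈ xs) (_∈? xs) (λ cover → not-cover cover)
  where
  open DecMembership (_≟_ {n}) using (_∈?_)
  not-cover : ¬ (∀ z → z ∈ xs)
  not-cover cover with pigeonhole short (λ z → index (cover z))
  ... | i , j , i<j , same-index =
    <⇒≢ i<j (trans (lookup-index (cover i))
              (trans (cong (lookup xs) same-index) (sym (lookup-index (cover j)))))

without-true : ∀ {n} {a b x : Fin n} → x ≢ a → x ≢ b → without a b x ≡ true
without-true {a = a} {b} {x} x≢a x≢b with x ≟ a | x ≟ b
... | yes x≡a | _       = contradiction x≡a x≢a
... | no _    | yes x≡b = contradiction x≡b x≢b
... | no _    | no _    = refl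

true-without : ∀ {n} {a b x : Fin n} → without a b x ≡ true → x ≢ a × x ≢ b
true-without {a = a} {b} {x} kept with x ≟ a | x ≟ b
true-without () | yes _ | _
true-without () | no _  | yes _
... | no x≢a | no x≢b = x≢a , x≢b

-- In a graph on at least 4 vertices that stays connected after deleting
-- any two vertices, every vertex x has a neighbour outside any pair {a, b}
-- not containing x: walk in G - {a, b} from x to a fourth vertex.
neighbour-avoiding : ∀ {n} (G : SimpleGraph n) → 3 ℕ.< n →
  (∀ a b → InducedConnected G (without a b)) →
  ∀ {x a b} → x ≢ a → x ≢ b → ∃ λ y → adj G x y ≡ true × y ≢ a × y ≢ b
neighbour-avoiding G big κ {x} {a} {b} x≢a x≢b with fresh (x ∷ a ∷ b ∷ []) big
... | z , z∉ with κ a b x z (without-true x≢a x≢b)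
                   (without-true (z∉ ∘ there ∘ here) (z∉ ∘ there ∘ there ∘ here))
...   | here                 = contradiction (here refl) z∉
...   | step {w = y} x~y kept _ = y , x~y , true-without kept

exit-edge : ∀ {n} (G : SimpleGraph n) {K : Fin n → Bool} {p} {P : Pred (Fin n) p} →
  Decidable P → ∀ {x z} → Reach G K x z → K x ≡ true → P x → ¬ P z →
  ∃₂ λ y y' → adj G y y' ≡ true × K y ≡ true × P y × ¬ P y'
exit-edge G P? here                          _    Px ¬Pz = contradiction Px ¬Pz
exit-edge G P? (step {u = x} {w = y} x~y Ky path) Kx Px ¬Pz with P? y
... | yes Py = exit-edge G P? path Ky Py ¬Pz
... | no ¬Py = x , y , x~y , Kx , Px , ¬Py

module MaximumArgument {n} (G : SimpleGraph n) (big : 3 ℕ.< n)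
  (κ : ∀ a b → InducedConnected G (without a b))
  {v w q : Fin n} (v≢w : v ≢ w) (q≢v : q ≢ v) (q≢w : q ≢ w)
  (h : Fin n → ℤ) (E : Divisor n) (E-eff : Effective E)
  (E≡ : ∀ x → E x ≡ (pt3 v v w x - pt q x) - outflow G h x) where

  slack : Fin n → ℤ
  slack x = pt3 v v w x - pt q x

  -- E(x) ≥ 0 at a maximum x: distinct lower neighbours are bounded by the slack.
  budget : ∀ {x zs} → IsMax h x → Unique zs → All (LowerNeighbour G h x) zs →
           + length zs ≤ slack x
  budget {x} x-max uniq lower =
    ℤP.≤-trans (outflow-bound G x-max uniq lower)
               (ℤP.0≤i-j⇒j≤i (subst (+ 0 ≤_) (E≡ x) (E-eff x)))

  slack-q : slack q ≡ -[1+ 0 ]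
  slack-q rewrite pt-other (q≢v ∘ sym) | pt-other (q≢w ∘ sym) | pt-self q = refl

  slack-other : ∀ {y} → y ≢ v → y ≢ w → y ≢ q → slack y ≡ + 0
  slack-other y≢v y≢w y≢q
    rewrite pt-other (y≢v ∘ sym) | pt-other (y≢w ∘ sym) | pt-other (y≢q ∘ sym) = refl

  slack-w : slack w ≡ + 1
  slack-w rewrite pt-other v≢w | pt-self w | pt-other (q≢w) = refl

  slack-v : slack v ≡ + 2
  slack-v rewrite pt-self v | pt-other (v≢w ∘ sym) | pt-other (q≢v) = refl

  M : ℤ
  M = h (proj₁ (argmax h v))

  Top : Fin n → Set
  Top x = h x ≡ M

  top-max : ∀ {x} → Top x → IsMax h x
  top-max {x} x-top y = subst (h y ≤_) (sym x-top) (proj₂ (argmax h v) y)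

  lower-neighbour : ∀ {x y} → Top x → adj G x y ≡ true → ¬ Top y → LowerNeighbour G h x y
  lower-neighbour x-top x~y y-low =
    x~y , ℤP.≤∧≢⇒< (top-max x-top _) (λ hy≡hx → y-low (trans hy≡hx x-top))

  -- q has negative slack, so it is not a maximum.
  q-not-top : ¬ Top q
  q-not-top q-top = contradiction (subst (+ 0 ≤_) slack-q (budget (top-max q-top) [] [])) λ ()

  -- A maximum off {v, w} leads, along a path to q in G - {v, w}, to a
  -- maximum of slack 0 with a lower neighbour.
  top-in-v-w : ∀ {x} → x ≢ v → x ≢ w → ¬ Top x
  top-in-v-w x≢v x≢w x-top
    with exit-edge G (λ y → h y ℤ.≟ M)
           (κ v w _ q (without-true x≢v x≢w) (without-true q≢v q≢w))
           (without-true x≢v x≢w) x-top q-not-top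
  ... | y , y' , y~y' , kept , y-top , y'-low with true-without kept
  ... | y≢v , y≢w =
    contradiction (subst (+ 1 ≤_) (slack-other y≢v y≢w (λ { refl → q-not-top y-top }))
                    (budget (top-max y-top) ([] ∷ []) (lower-neighbour y-top y~y' y'-low ∷ [])))
                  λ { (ℤ.+≤+ ()) }

  lower-off-v-w : ∀ {x y} → Top x → adj G x y ≡ true → y ≢ v → y ≢ w → LowerNeighbour G h x y
  lower-off-v-w x-top x~y y≢v y≢w = lower-neighbour x-top x~y (top-in-v-w y≢v y≢w)

  w≢v : w ≢ v
  w≢v = v≢w ∘ sym

  -- w has slack 1 but two neighbours outside v, both lower.
  w-not-top : ¬ Top w
  w-not-top w-top with neighbour-avoiding G big κ w≢v w≢v
  ... | y₁ , w~y₁ , y₁≢v , _ with neighbour-avoiding G big κ w≢v (adjacent⇒distinct G w~y₁)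
  ... | y₂ , w~y₂ , y₂≢v , y₂≢y₁ =
    contradiction (subst (+ 2 ≤_) slack-w
                    (budget (top-max w-top) ((y₁≢y₂ ∷ []) ∷ [] ∷ [])
                      (lower w~y₁ y₁≢v ∷ lower w~y₂ y₂≢v ∷ [])))
                  λ { (ℤ.+≤+ (ℕ.s≤s ())) }
    where
    y₁≢y₂ : y₁ ≢ y₂
    y₁≢y₂ = y₂≢y₁ ∘ sym
    lower : ∀ {y} → adj G w y ≡ true → y ≢ v → LowerNeighbour G h w y
    lower w~y y≢v = lower-off-v-w w-top w~y y≢v (adjacent⇒distinct G w~y ∘ sym)

  -- v has slack 2 but three distinct neighbours, all lower.
  v-not-top : ¬ Top v
  v-not-top v-top with neighbour-avoiding G big κ v≢w v≢w
  ... | y₁ , v~y₁ , _ with neighbour-avoiding G big κ (adjacent⇒distinct G v~y₁)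
                                                      (adjacent⇒distinct G v~y₁)
  ... | y₂ , v~y₂ , y₂≢y₁ , _ with neighbour-avoiding G big κ (adjacent⇒distinct G v~y₁)
                                                             (adjacent⇒distinct G v~y₂)
  ... | y₃ , v~y₃ , y₃≢y₁ , y₃≢y₂ =
    contradiction (subst (+ 3 ≤_) slack-v
                    (budget (top-max v-top)
                      (((y₂≢y₁ ∘ sym) ∷ (y₃≢y₁ ∘ sym) ∷ []) ∷ ((y₃≢y₂ ∘ sym) ∷ []) ∷ [] ∷ [])
                      (lower v~y₁ ∷ lower v~y₂ ∷ lower v~y₃ ∷ [])))
                  λ { (ℤ.+≤+ (ℕ.s≤s (ℕ.s≤s ()))) }
    where
    lower : ∀ {y} → adj G v y ≡ true → LowerNeighbour G h v y
    lower {y} v~y with y ≟ w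
    ... | yes refl = lower-neighbour v-top v~y w-not-top
    ... | no y≢w   = lower-off-v-w v-top v~y (adjacent⇒distinct G v~y ∘ sym) y≢w

  absurd : ⊥
  absurd with proj₁ (argmax h v) ≟ v | proj₁ (argmax h v) ≟ w
  ... | yes top≡v | _         = v-not-top (cong h (sym top≡v))
  ... | no _      | yes top≡w = w-not-top (cong h (sym top≡w))
  ... | no top≢v  | no top≢w  = top-in-v-w top≢v top≢w refl

no-rank-one-2v+w : ∀ {n} (G : SimpleGraph n) → 3 ℕ.< n →
  (∀ a b → InducedConnected G (without a b)) →
  (D : Divisor n) → RankProp G D 1 → ∀ {v w} → v ≢ w → LinEq G D (pt3 v v w) → ⊥
no-rank-one-2v+w G big κ D rank≥1 {v} {w} v≢w (g , D-P≡Δg)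
  with fresh (v ∷ w ∷ []) (ℕP.<⇒≤ big)
... | q , q∉ with rank≥1 (pt q) (pt-effective q) (Σ-pt q)
... | E , E-eff , (f , D-q-E≡Δf) =
  MaximumArgument.absurd G big κ v≢w (q∉ ∘ here) (q∉ ∘ there ∘ here) h E E-eff E≡
  where
  h : Fin _ → ℤ
  h y = f y - g y
  rearrange : ∀ d p e q → e ≡ (p - q) - ((d - q - e) - (d - p))
  rearrange = solve-∀
  E≡ : ∀ x → E x ≡ (pt3 v v w x - pt q x) - outflow G h x
  E≡ x = begin
      E x
    ≡⟨ rearrange (D x) (pt3 v v w x) (E x) (pt q x) ⟩
      (pt3 v v w x - pt q x) - ((D x - pt q x - E x) - (D x - pt3 v v w x))
    ≡⟨ cong ((pt3 v v w x - pt q x) -_)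
            (trans (cong₂ _-_ (D-q-E≡Δf x) (D-P≡Δg x)) (Lap-sub G f g x)) ⟩
      (pt3 v v w x - pt q x) - Lap G h x
    ≡⟨ cong ((pt3 v v w x - pt q x) -_) (Lap-outflow G h x) ⟩
      (pt3 v v w x - pt q x) - outflow G h x
    ∎
    where open ≡-Reasoning

LinEq-resp : ∀ {n} (G : SimpleGraph n) (D : Divisor n) {P P' : Divisor n} →
  (∀ x → P x ≡ P' x) → LinEq G D P → LinEq G D P'
LinEq-resp G D P≡P' (f , D-P≡Δf) =
  f , λ x → trans (cong (D x -_) (sym (P≡P' x))) (D-P≡Δf x)

pt3-swap : ∀ {n} (a b c x : Fin n) → pt3 a b c x ≡ pt3 a c b x
pt3-swap a b c x = swap (pt a x) (pt b x) (pt c x)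
  where
  swap : ∀ i j k → i + j + k ≡ i + k + j
  swap = solve-∀

pt3-rotate : ∀ {n} (a b c x : Fin n) → pt3 a b c x ≡ pt3 b c a x
pt3-rotate a b c x = rotate (pt a x) (pt b x) (pt c x)
  where
  rotate : ∀ i j k → i + j + k ≡ j + k + i
  rotate = solve-∀

lemma4p2 : {n : ℕ} (G : SimpleGraph n) → ThreeConnected G → GonalityIs G 3 →
    (D : Divisor n) → Effective D → RankIs G D 1 → deg D ≡ + 3 →
    (v₁ v₂ v₃ : Fin n) → LinEq G D (pt3 v₁ v₂ v₃) →
    (v₁ ≡ v₂ × v₂ ≡ v₃) ⊎ (v₁ ≢ v₂ × v₂ ≢ v₃ × v₁ ≢ v₃)
lemma4p2 G (big , _ , κ) _ D _ (_ , rank≥1 , _) _ v₁ v₂ v₃ D~P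
  with v₁ ≟ v₂ | v₂ ≟ v₃ | v₁ ≟ v₃
... | yes v₁≡v₂ | yes v₂≡v₃ | _        = inj₁ (v₁≡v₂ , v₂≡v₃)
... | no v₁≢v₂  | no v₂≢v₃  | no v₁≢v₃ = inj₂ (v₁≢v₂ , v₂≢v₃ , v₁≢v₃)
... | yes refl  | no v₁≢v₃  | _        =
  ⊥-elim (no-rank-one-2v+w G big κ D rank≥1 v₁≢v₃ D~P)
... | no v₁≢v₂  | _         | yes refl =
  ⊥-elim (no-rank-one-2v+w G big κ D rank≥1 v₁≢v₂
            (LinEq-resp G D (pt3-swap v₁ v₂ v₁) D~P))
... | no v₁≢v₂  | yes refl  | no _     =
  ⊥-elim (no-rank-one-2v+w G big κ D rank≥1 (v₁≢v₂ ∘ sym)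
            (LinEq-resp G D (pt3-rotate v₁ v₂ v₂) D~P))
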